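{- Let $n\ge1$, let $\pi=\pi_1\cdots\pi_n\in\mathcal S_n$ with $\pi_1=i$, and let $\pi'=\mathrm{red}(\pi_2\cdots\pi_n)\in\mathcal S_{n-1}$. Then $$\mathrm{weight}(\pi)=x_{i,1}^{0}x_{i,2}^{1}\cdots x_{i,i}^{i-1}\cdot\mathrm{weight}(\pi')\big|_A,$$ where $A$ is the simultaneous substitution, for the variables $x_{b,c}$ ($1\le c\le b\le n-1$) of $\mathrm{weight}(\pi')$: $x_{b,c}\to x_{b+1,c}$ if $b\ge i,\ c<i$; $x_{b,c}\to x_{b+1,c+1}$ if $b\ge i,\ c>i$; $x_{b,c}\to t\,x_{b+1,c}\,x_{b+1,c+1}$ if $b\ge i,\ c=i$; and $x_{b,c}$ unchanged if $b<i$.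
   Context: For a sequence $\sigma$ of $k$ distinct positive integers, $\mathrm{red}(\sigma)$ is the unique $\tau\in\mathcal S_k$ order-isomorphic to $\sigma$. For $\pi\in\mathcal S_m$, $N_{231}(\pi)$ is the number of index triples $a<b<c$ with $\pi_c<\pi_a<\pi_b$. With variables $t$ and $x_{i,j}$ ($1\le j\le i$), define $$\mathrm{weight}(\pi)=t^{N_{231}(\pi)}\prod_{1\le j\le i\le m}x_{i,j}^{\#\{(a,b):\,1\le a<b\le m,\ \pi_a=i,\ \pi_b<j\}}.$$ -}

module Defs where

open import Data.Nat using (ℕ; zero; suc; _≤_; _<_; _<ᵇ_; _≡ᵇ_; _∸_)
open import Data.Fin using (Fin; toℕ)
open import Data.Vec using (Vec; lookup)
open import Data.List using (List; []; _∷_; _++_; map; concatMap; replicate; upTo; allFin; cartesianProduct; length; filterᵇ)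
open import Data.Bool using (Bool; true; false; _∧_; if_then_else_)
open import Data.Product using (_×_; _,_)
open import Relation.Binary.PropositionalEquality using (_≡_)

data Var : Set where
  t : Var
  x : ℕ → ℕ → Var

-- A monomial in commuting variables is represented as a list of variable
-- occurrences; two monomials are equal iff the lists are permutations of
-- each other (_↭_).

range1 : ℕ → List ℕ
range1 k = map suc (upTo k)

countL : {A : Set} → (A → Bool) → List A → ℕ
countL p xs = length (filterᵇ p xs)

_<F_ : {m : ℕ} → Fin m → Fin m → Bool
a <F b = toℕ a <ᵇ toℕ b

pairs : (m : ℕ) → List (Fin m × Fin m)
pairs m = cartesianProduct (allFin m) (allFin m)

triples : (m : ℕ) → List (Fin m × (Fin m × Fin m))
triples m = cartesianProduct (allFin m) (pairs m)

IsPerm : (m : ℕ) → Vec ℕ m → Set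
IsPerm m π = ((a : Fin m) → (1 ≤ lookup π a) × (lookup π a ≤ m))
           × ((a b : Fin m) → lookup π a ≡ lookup π b → a ≡ b)

-- σ and τ are order-isomorphic (so τ = red σ when τ ∈ S_k).
OrderIso : {k : ℕ} → Vec ℕ k → Vec ℕ k → Set
OrderIso {k} σ τ = (a b : Fin k) →
  (lookup σ a < lookup σ b → lookup τ a < lookup τ b) ×
  (lookup τ a < lookup τ b → lookup σ a < lookup σ b)

N231 : {m : ℕ} → Vec ℕ m → ℕ
N231 {m} π = countL cond (triples m)
  where
  cond : Fin m × (Fin m × Fin m) → Bool
  cond (a , (b , c)) = (a <F b) ∧ (b <F c) ∧ (lookup π c <ᵇ lookup π a) ∧ (lookup π a <ᵇ lookup π b)

xexp : {m : ℕ} → Vec ℕ m → ℕ → ℕ → ℕ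
xexp {m} π i j = countL cond (pairs m)
  where
  cond : Fin m × Fin m → Bool
  cond (a , b) = (a <F b) ∧ (lookup π a ≡ᵇ i) ∧ (lookup π b <ᵇ j)

weight : {m : ℕ} → Vec ℕ m → List Var
weight {m} π = replicate (N231 π) t
  ++ concatMap (λ i → concatMap (λ j → replicate (xexp π i j) (x i j)) (range1 i)) (range1 m)

prefix : ℕ → List Var
prefix i = concatMap (λ j → replicate (j ∸ 1) (x i j)) (range1 i)

substA : ℕ → Var → List Var
substA i t = t ∷ []
substA i (x b c) =
  if b <ᵇ i then x b c ∷ []
  else if c <ᵇ i then x (suc b) c ∷ []
  else if i <ᵇ c then x (suc b) (suc c) ∷ []
  else t ∷ x (suc b) c ∷ x (suc b) (suc c) ∷ []

applyA : ℕ → List Var → List Var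
applyA i w = concatMap (substA i) w

-- Since π = i · rest is a permutation, rest is π′ = red rest with every value ≥ i raised by
-- one (punchIn i). A monomial is a list of variables up to permutation, so it suffices to compare the
-- multiplicity of every variable on both sides. For x_{p,q} with p ≠ i, the pairs counted in π are
-- those counted by x_{p′,q′} in π′, where p′, q′ are p, q pulled back along punchIn i, and A sends
-- x_{p′,q′} to x_{p,q}. The pairs counted by x_{i,q} all start at the first letter, and there are
-- q − 1 of them: this is the prefix. The 231-patterns of π are those of π′ plus those starting at
-- the first letter, i.e. positions b < c with π′_b ≥ i > π′_c; the latter are the pairs counted by
-- x_{r,i} (r ≥ i) in π′, each of which A turns into one factor t.

module Submission where

open import Defs
open import Algebra.Properties.CommutativeSemigroup using (interchange; x∙yz≈y∙xz)
open import Data.Bool using (Bool; true; false; _∧_; not; if_then_else_; T)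
open import Data.Bool.Properties using (T-≡; ¬-not; ⇔→≡; ∧-zeroʳ)
open import Data.Fin using (Fin) renaming (zero to fzero; suc to fsuc)
import Data.Fin.Properties as Fin
open import Data.List using (List; []; _∷_; _++_; map; concatMap; replicate; upTo; allFin; cartesianProduct; length)
open import Data.List.Membership.Propositional using (_∈_)
open import Data.List.Membership.Propositional.Properties using (∈-∃++; ∈-map⁺; ∈-map⁻; ∈-upTo⁺; ∈-upTo⁻)
open import Data.List.Properties using (map-applyUpTo; map-tabulate; length-map; length-applyUpTo; length-tabulate)
open import Data.List.Relation.Binary.Permutation.Propositional using (_↭_; ↭-refl; ↭-prep; ↭-sym; ↭-trans)
open import Data.List.Relation.Binary.Permutation.Propositional.Properties using (shift)
open import Data.List.Relation.Unary.Any using (here; there)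
open import Data.Nat using (ℕ; zero; suc; pred; _+_; _*_; _∸_; _≤_; _<_; _≮_; z≤n; s≤s; z<s; _<ᵇ_; _≡ᵇ_; _<?_; _≤?_)
open import Data.Nat.Properties
open import Data.Product using (_×_; _,_; proj₁; proj₂)
open import Data.Vec using (Vec; _∷_; lookup)
open import Function using (_∘_; id; _⇔_; mk⇔; Equivalence)
open import Relation.Binary.Definitions using (DecidableEquality; tri<; tri≈; tri>)
open import Relation.Binary.PropositionalEquality
open import Relation.Nullary using (¬_; Dec; yes; no; does; contradiction; _×-dec_)

open Equivalence using (to; from)

⟦_⟧ : Bool → ℕ
⟦ true ⟧ = 1
⟦ false ⟧ = 0

<ᵇ-true : ∀ {m n} → m < n → (m <ᵇ n) ≡ true
<ᵇ-true m<n = to T-≡ (<⇒<ᵇ m<n)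

<ᵇ-false : ∀ {m n} → m ≮ n → (m <ᵇ n) ≡ false
<ᵇ-false {m} {n} m≮n = ¬-not (m≮n ∘ <ᵇ⇒< m n ∘ from T-≡)

≡ᵇ-true : ∀ {m n} → m ≡ n → (m ≡ᵇ n) ≡ true
≡ᵇ-true {m} {n} m≡n = to T-≡ (≡⇒≡ᵇ m n m≡n)

≡ᵇ-false : ∀ {m n} → m ≢ n → (m ≡ᵇ n) ≡ false
≡ᵇ-false {m} {n} m≢n = ¬-not (m≢n ∘ ≡ᵇ⇒≡ m n ∘ from T-≡)

≡ᵇ-refl : ∀ n → (n ≡ᵇ n) ≡ true
≡ᵇ-refl n = ≡ᵇ-true {n} refl

≡ᵇ-sound : ∀ {m n} → (m ≡ᵇ n) ≡ true → m ≡ n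
≡ᵇ-sound {m} {n} = ≡ᵇ⇒≡ m n ∘ from T-≡

<ᵇ-cong : ∀ {a b c d} → (a < b ⇔ c < d) → (a <ᵇ b) ≡ (c <ᵇ d)
<ᵇ-cong {a} {b} {c} {d} a<b⇔c<d = ⇔→≡ {z = true} (mk⇔
  (to T-≡ ∘ <⇒<ᵇ ∘ to a<b⇔c<d ∘ <ᵇ⇒< a b ∘ from T-≡)
  (to T-≡ ∘ <⇒<ᵇ ∘ from a<b⇔c<d ∘ <ᵇ⇒< c d ∘ from T-≡))

≡ᵇ-cong : ∀ {a b c d} → (a ≡ b ⇔ c ≡ d) → (a ≡ᵇ b) ≡ (c ≡ᵇ d)
≡ᵇ-cong {a} {b} {c} {d} a≡b⇔c≡d = ⇔→≡ {z = true} (mk⇔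
  (to T-≡ ∘ ≡⇒≡ᵇ c d ∘ to a≡b⇔c≡d ∘ ≡ᵇ⇒≡ a b ∘ from T-≡)
  (to T-≡ ∘ ≡⇒≡ᵇ a b ∘ from a≡b⇔c≡d ∘ ≡ᵇ⇒≡ c d ∘ from T-≡))

<ᵇ-≡⇒⇔ : ∀ {a b c d} → (a <ᵇ b) ≡ (c <ᵇ d) → (a < b ⇔ c < d)
<ᵇ-≡⇒⇔ {a} {b} {c} {d} eq = mk⇔
  (λ a<b → <ᵇ⇒< c d (subst T eq (<⇒<ᵇ a<b)))
  (λ c<d → <ᵇ⇒< a b (subst T (sym eq) (<⇒<ᵇ c<d)))

⟦<ᵇ-suc⟧ : ∀ w k → ⟦ w <ᵇ suc k ⟧ ≡ ⟦ w <ᵇ k ⟧ + ⟦ w ≡ᵇ k ⟧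
⟦<ᵇ-suc⟧ zero zero = refl
⟦<ᵇ-suc⟧ zero (suc k) = refl
⟦<ᵇ-suc⟧ (suc w) zero = refl
⟦<ᵇ-suc⟧ (suc w) (suc k) = ⟦<ᵇ-suc⟧ w k

⟦∧∧not⟧ : ∀ u v w → ⟦ u ∧ v ∧ not w ⟧ ≡ (if w then 0 else ⟦ u ∧ v ⟧)
⟦∧∧not⟧ true true true = refl
⟦∧∧not⟧ true true false = refl
⟦∧∧not⟧ true false true = refl
⟦∧∧not⟧ true false false = refl
⟦∧∧not⟧ false v true = refl
⟦∧∧not⟧ false v false = refl

∑ : {A : Set} → List A → (A → ℕ) → ℕ
∑ [] f = 0
∑ (a ∷ as) f = f a + ∑ as f

module _ {A : Set} where

  ∑-cong : ∀ (as : List A) {f g : A → ℕ} → (∀ a → f a ≡ g a) → ∑ as f ≡ ∑ as g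
  ∑-cong [] f≗g = refl
  ∑-cong (a ∷ as) f≗g = cong₂ _+_ (f≗g a) (∑-cong as f≗g)

  ∑-cong-∈ : ∀ (as : List A) {f g : A → ℕ} → (∀ {a} → a ∈ as → f a ≡ g a) → ∑ as f ≡ ∑ as g
  ∑-cong-∈ [] f≗g = refl
  ∑-cong-∈ (a ∷ as) f≗g = cong₂ _+_ (f≗g (here refl)) (∑-cong-∈ as (f≗g ∘ there))

  ∑-0 : ∀ (as : List A) {f : A → ℕ} → (∀ a → f a ≡ 0) → ∑ as f ≡ 0
  ∑-0 as f≗0 = trans (∑-cong as f≗0) (∑-zero as)
    where
    ∑-zero : ∀ (as : List A) → ∑ as (λ _ → 0) ≡ 0
    ∑-zero [] = refl
    ∑-zero (_ ∷ as) = ∑-zero as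

  ∑-+ : ∀ (as : List A) (f g : A → ℕ) → ∑ as (λ a → f a + g a) ≡ ∑ as f + ∑ as g
  ∑-+ [] f g = refl
  ∑-+ (a ∷ as) f g = trans (cong (f a + g a +_) (∑-+ as f g)) (interchange +-commutativeSemigroup (f a) (g a) _ _)

  ∑-++ : ∀ (as bs : List A) (f : A → ℕ) → ∑ (as ++ bs) f ≡ ∑ as f + ∑ bs f
  ∑-++ [] bs f = refl
  ∑-++ (a ∷ as) bs f = trans (cong (f a +_) (∑-++ as bs f)) (sym (+-assoc (f a) _ _))

  ∑-replicate : ∀ n (a : A) (f : A → ℕ) → ∑ (replicate n a) f ≡ n * f a
  ∑-replicate zero a f = refl
  ∑-replicate (suc n) a f = cong (f a +_) (∑-replicate n a f)

  ∑-length : ∀ (as : List A) → ∑ as (λ _ → 1) ≡ length as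
  ∑-length [] = refl
  ∑-length (_ ∷ as) = cong suc (∑-length as)

  ∑-if : ∀ (β : Bool) (as : List A) (f : A → ℕ) → (if β then 0 else ∑ as f) ≡ ∑ as (λ a → if β then 0 else f a)
  ∑-if true as f = sym (∑-0 as (λ _ → refl))
  ∑-if false as f = refl

  ∑-countL : ∀ (p : A → Bool) (as : List A) → countL p as ≡ ∑ as (λ a → ⟦ p a ⟧)
  ∑-countL p [] = refl
  ∑-countL p (a ∷ as) with p a
  ... | true = cong suc (∑-countL p as)
  ... | false = ∑-countL p as

  ∑≤1≡length⇒≡1 : ∀ (as : List A) (f : A → ℕ) → (∀ a → f a ≤ 1) → ∑ as f ≡ length as → ∀ {a} → a ∈ as → f a ≡ 1
  ∑≤1≡length⇒≡1 (b ∷ as) f f≤1 total = go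
    where
    ∑≤length : ∀ bs → ∑ bs f ≤ length bs
    ∑≤length [] = z≤n
    ∑≤length (c ∷ bs) = +-mono-≤ (f≤1 c) (∑≤length bs)
    ≡1 : ∀ k → k ≤ 1 → k + ∑ as f ≡ suc (length as) → k ≡ 1
    ≡1 0 _ total′ = contradiction (subst (_≤ length as) total′ (∑≤length as)) (<⇒≱ (n<1+n _))
    ≡1 1 _ _ = refl
    ≡1 (suc (suc _)) (s≤s ()) _
    head≡1 : f b ≡ 1
    head≡1 = ≡1 (f b) (f≤1 b) total
    go : ∀ {a} → a ∈ b ∷ as → f a ≡ 1
    go (here refl) = head≡1
    go (there a∈as) = ∑≤1≡length⇒≡1 as f f≤1 (suc-injective (trans (cong (_+ ∑ as f) (sym head≡1)) total)) a∈as

module _ {A B : Set} where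

  ∑-map : ∀ (as : List A) (g : A → B) (f : B → ℕ) → ∑ (map g as) f ≡ ∑ as (f ∘ g)
  ∑-map [] g f = refl
  ∑-map (a ∷ as) g f = cong (f (g a) +_) (∑-map as g f)

  ∑-concatMap : ∀ (as : List A) (g : A → List B) (f : B → ℕ) → ∑ (concatMap g as) f ≡ ∑ as (λ a → ∑ (g a) f)
  ∑-concatMap [] g f = refl
  ∑-concatMap (a ∷ as) g f = trans (∑-++ (g a) (concatMap g as) f) (cong (∑ (g a) f +_) (∑-concatMap as g f))

  ∑-swap : ∀ (as : List A) (bs : List B) (f : A → B → ℕ) → ∑ as (λ a → ∑ bs (f a)) ≡ ∑ bs (λ b → ∑ as (λ a → f a b))
  ∑-swap [] bs f = sym (∑-0 bs (λ _ → refl))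
  ∑-swap (a ∷ as) bs f = trans (cong (∑ bs (f a) +_) (∑-swap as bs f)) (sym (∑-+ bs (f a) _))

∑-cartesianProduct : ∀ {A B : Set} (as : List A) (bs : List B) (f : A × B → ℕ) →
  ∑ (cartesianProduct as bs) f ≡ ∑ as (λ a → ∑ bs (λ b → f (a , b)))
∑-cartesianProduct [] bs f = refl
∑-cartesianProduct (a ∷ as) bs f =
  trans (∑-++ (map (a ,_) bs) _ f) (cong₂ _+_ (∑-map bs (a ,_) f) (∑-cartesianProduct as bs f))

range1-suc : ∀ n → range1 (suc n) ≡ 1 ∷ map suc (range1 n)
range1-suc n = cong (λ ns → 1 ∷ map suc ns) (sym (map-applyUpTo id suc n))

length-range1 : ∀ n → length (range1 n) ≡ n
length-range1 n = trans (length-map suc (upTo n)) (length-applyUpTo id n)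

∈-range1⁺ : ∀ {n b} → 1 ≤ b → b ≤ n → b ∈ range1 n
∈-range1⁺ {b = suc k} _ b≤n = ∈-map⁺ suc (∈-upTo⁺ b≤n)

∈-range1⁻ : ∀ {n b} → b ∈ range1 n → 1 ≤ b × b ≤ n
∈-range1⁻ b∈ with k , k∈ , refl ← ∈-map⁻ suc b∈ = s≤s z≤n , ∈-upTo⁻ k∈

∑-range1-suc : ∀ n (f : ℕ → ℕ) → ∑ (range1 (suc n)) f ≡ f 1 + ∑ (range1 n) (f ∘ suc)
∑-range1-suc n f = trans (cong (λ bs → ∑ bs f) (range1-suc n)) (cong (f 1 +_) (∑-map (range1 n) suc f))

∑-range1-0 : ∀ n (f : ℕ → ℕ) → (∀ b → 1 ≤ b → b ≤ n → f b ≡ 0) → ∑ (range1 n) f ≡ 0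
∑-range1-0 n f f≗0 =
  trans (∑-cong-∈ (range1 n) (λ b∈ → let (1≤b , b≤n) = ∈-range1⁻ b∈ in f≗0 _ 1≤b b≤n)) (∑-0 (range1 n) (λ _ → refl))

∑-range1-single : ∀ n (f : ℕ → ℕ) {b₀} → 1 ≤ b₀ → b₀ ≤ n → (∀ b → b ≢ b₀ → f b ≡ 0) → ∑ (range1 n) f ≡ f b₀
∑-range1-single (suc n) f {1} _ _ f≗0 = begin
  ∑ (range1 (suc n)) f          ≡⟨ ∑-range1-suc n f ⟩
  f 1 + ∑ (range1 n) (f ∘ suc)  ≡⟨ cong (f 1 +_) (∑-range1-0 n (f ∘ suc) (λ { (suc b) _ _ → f≗0 (2 + b) λ () })) ⟩
  f 1 + 0                       ≡⟨ +-identityʳ (f 1) ⟩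
  f 1                           ∎
  where open ≡-Reasoning
∑-range1-single (suc n) f {suc (suc k)} _ b₀≤n f≗0 = begin
  ∑ (range1 (suc n)) f          ≡⟨ ∑-range1-suc n f ⟩
  f 1 + ∑ (range1 n) (f ∘ suc)  ≡⟨ cong₂ _+_ (f≗0 1 λ ())
                                      (∑-range1-single n (f ∘ suc) (s≤s z≤n) (≤-pred b₀≤n) λ b b≢ → f≗0 (suc b) (b≢ ∘ suc-injective)) ⟩
  f (2 + k)                     ∎
  where open ≡-Reasoning

∑ᶠ : ∀ {m} → (Fin m → ℕ) → ℕ
∑ᶠ {m} = ∑ (allFin m)

syntax ∑ᶠ (λ a → e) = ∑[ a ] e

∑ᶠ-suc : ∀ {m} (f : Fin (suc m) → ℕ) → ∑ᶠ f ≡ f fzero + ∑[ a ] f (fsuc a)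
∑ᶠ-suc {m} f = cong (f fzero +_) (trans (cong (λ as → ∑ as f) (sym (map-tabulate id fsuc))) (∑-map (allFin m) fsuc f))

module Multiplicity {A : Set} (_≟_ : DecidableEquality A) where

  δ : A → A → ℕ
  δ v w = ⟦ does (v ≟ w) ⟧

  δ-refl : ∀ v → δ v v ≡ 1
  δ-refl v with v ≟ v
  ... | yes _ = refl
  ... | no v≢v = contradiction refl v≢v

  δ-≢ : ∀ {v w} → v ≢ w → δ v w ≡ 0
  δ-≢ {v} {w} v≢w with v ≟ w
  ... | yes v≡w = contradiction v≡w v≢w
  ... | no _ = refl

  δ-cong : ∀ {v w v′ w′} → (v ≡ w ⇔ v′ ≡ w′) → δ v w ≡ δ v′ w′
  δ-cong {v} {w} {v′} {w′} v≡w⇔v′≡w′ with v ≟ w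
  ... | yes v≡w = sym (δ-refl′ (to v≡w⇔v′≡w′ v≡w))
    where
    δ-refl′ : ∀ {a b} → a ≡ b → δ a b ≡ 1
    δ-refl′ {a} refl = δ-refl a
  ... | no v≢w = sym (δ-≢ (v≢w ∘ from v≡w⇔v′≡w′))

  mult : A → List A → ℕ
  mult v xs = ∑ xs (δ v)

  mult-++ : ∀ v xs ys → mult v (xs ++ ys) ≡ mult v xs + mult v ys
  mult-++ v xs ys = ∑-++ xs ys (δ v)

  mult>0⇒∈ : ∀ {v} xs → 0 < mult v xs → v ∈ xs
  mult>0⇒∈ {v} (w ∷ xs) mult>0 with v ≟ w
  ... | yes refl = here refl
  ... | no _ = there (mult>0⇒∈ xs mult>0)

  mult-≡⇒↭ : ∀ xs ys → (∀ v → mult v xs ≡ mult v ys) → xs ↭ ys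
  mult-≡⇒↭ [] [] _ = ↭-refl
  mult-≡⇒↭ [] (y ∷ ys) same = contradiction (trans (same y) (cong (_+ mult y ys) (δ-refl y))) 0≢1+n
  mult-≡⇒↭ (v ∷ xs) ys same
    with ys₁ , ys₂ , refl ← ∈-∃++ (mult>0⇒∈ ys (subst (0 <_) (trans (cong (_+ mult v xs) (sym (δ-refl v))) (same v)) z<s))
    = ↭-trans (↭-prep v (mult-≡⇒↭ xs (ys₁ ++ ys₂) same′)) (↭-sym (shift v ys₁ ys₂))
    where
    same′ : ∀ w → mult w xs ≡ mult w (ys₁ ++ ys₂)
    same′ w = +-cancelˡ-≡ (δ w v) _ _ (begin
      δ w v + mult w xs                   ≡⟨ same w ⟩
      mult w (ys₁ ++ v ∷ ys₂)             ≡⟨ mult-++ w ys₁ (v ∷ ys₂) ⟩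
      mult w ys₁ + (δ w v + mult w ys₂)   ≡⟨ x∙yz≈y∙xz +-commutativeSemigroup (mult w ys₁) (δ w v) _ ⟩
      δ w v + (mult w ys₁ + mult w ys₂)   ≡⟨ cong (δ w v +_) (sym (mult-++ w ys₁ ys₂)) ⟩
      δ w v + mult w (ys₁ ++ ys₂)         ∎)
      where open ≡-Reasoning

_≟ⱽ_ : DecidableEquality Var
t ≟ⱽ t = yes refl
t ≟ⱽ x _ _ = no λ ()
x _ _ ≟ⱽ t = no λ ()
x a b ≟ⱽ x c d with a ≟ c | b ≟ d
... | yes refl | yes refl = yes refl
... | no a≢c | _ = no λ { refl → a≢c refl }
... | yes _ | no b≢d = no λ { refl → b≢d refl }

open Multiplicity _≟ⱽ_

δ-x-≢ˡ : ∀ {p q b c} → p ≢ b → δ (x p q) (x b c) ≡ 0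
δ-x-≢ˡ {p} {q} {b} {c} p≢b = δ-≢ {x p q} {x b c} λ { refl → p≢b refl }

δ-x-≢ʳ : ∀ {p q b c} → q ≢ c → δ (x p q) (x b c) ≡ 0
δ-x-≢ʳ {p} {q} {b} {c} q≢c = δ-≢ {x p q} {x b c} λ { refl → q≢c refl }

δ-x-cong : ∀ {p q b c p′ q′ b′ c′} → (p ≡ b ⇔ p′ ≡ b′) → (q ≡ c ⇔ q′ ≡ c′) →
  δ (x p q) (x b c) ≡ δ (x p′ q′) (x b′ c′)
δ-x-cong {p} {q} {b} {c} {p′} {q′} {b′} {c′} p⇔p′ q⇔q′ = δ-cong {x p q} {x b c} {x p′ q′} {x b′ c′} (mk⇔
  (λ { refl → cong₂ x (to p⇔p′ refl) (to q⇔q′ refl) })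
  (λ { refl → cong₂ x (from p⇔p′ refl) (from q⇔q′ refl) }))

IsPermFn : (m : ℕ) → (Fin m → ℕ) → Set
IsPermFn m g = ((a : Fin m) → (1 ≤ g a) × (g a ≤ m)) × ((a b : Fin m) → g a ≡ g b → a ≡ b)

injective⇒hits≤1 : ∀ {n} (g : Fin n → ℕ) → (∀ a b → g a ≡ g b → a ≡ b) → ∀ v → ∑[ b ] ⟦ g b ≡ᵇ v ⟧ ≤ 1
injective⇒hits≤1 {zero} g _ v = z≤n
injective⇒hits≤1 {suc n} g injective v rewrite ∑ᶠ-suc (λ b → ⟦ g b ≡ᵇ v ⟧) with g fzero ≡ᵇ v in g₀≡v
... | true = ≤-reflexive (cong suc (∑-0 (allFin n) λ b →
               cong ⟦_⟧ (≡ᵇ-false λ gb≡v → Fin.0≢1+n (injective _ _ (trans (≡ᵇ-sound g₀≡v) (sym gb≡v))))))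
... | false = injective⇒hits≤1 (g ∘ fsuc) (λ a b → Fin.suc-injective ∘ injective _ _) v

module PermFn {m : ℕ} {g : Fin m → ℕ} (g-perm : IsPermFn m g) where

  private
    g-bounded = proj₁ g-perm
    g-injective = proj₂ g-perm

  hits-total : ∑ (range1 m) (λ v → ∑[ b ] ⟦ g b ≡ᵇ v ⟧) ≡ m
  hits-total = begin
    ∑ (range1 m) (λ v → ∑[ b ] ⟦ g b ≡ᵇ v ⟧)    ≡⟨ ∑-swap (range1 m) (allFin m) _ ⟩
    ∑[ b ] (∑ (range1 m) λ v → ⟦ g b ≡ᵇ v ⟧)    ≡⟨ ∑-cong (allFin m) hit-once ⟩
    ∑ (allFin m) (λ _ → 1)                      ≡⟨ ∑-length (allFin m) ⟩
    length (allFin m)                           ≡⟨ length-tabulate {n = m} id ⟩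
    m                                           ∎
    where
    open ≡-Reasoning
    hit-once : ∀ b → ∑ (range1 m) (λ v → ⟦ g b ≡ᵇ v ⟧) ≡ 1
    hit-once b = let (1≤gb , gb≤m) = g-bounded b in
      trans (∑-range1-single m _ 1≤gb gb≤m (λ v v≢gb → cong ⟦_⟧ (≡ᵇ-false (v≢gb ∘ sym)))) (cong ⟦_⟧ (≡ᵇ-refl (g b)))

  hits-≡1 : ∀ {v} → 1 ≤ v → v ≤ m → ∑[ b ] ⟦ g b ≡ᵇ v ⟧ ≡ 1
  hits-≡1 1≤v v≤m = ∑≤1≡length⇒≡1 (range1 m) _ (injective⇒hits≤1 g g-injective)
    (trans hits-total (sym (length-range1 m))) (∈-range1⁺ 1≤v v≤m)

  count-below : ∀ k → k ≤ m → ∑[ b ] ⟦ g b <ᵇ suc k ⟧ ≡ k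
  count-below zero _ = ∑-0 (allFin m) (λ b → cong ⟦_⟧ (<ᵇ-false (≤⇒≯ (proj₁ (g-bounded b)))))
  count-below (suc k) k<m = begin
    ∑[ b ] ⟦ g b <ᵇ suc (suc k) ⟧                          ≡⟨ ∑-cong (allFin m) (λ b → ⟦<ᵇ-suc⟧ (g b) (suc k)) ⟩
    ∑[ b ] (⟦ g b <ᵇ suc k ⟧ + ⟦ g b ≡ᵇ suc k ⟧)           ≡⟨ ∑-+ (allFin m) _ _ ⟩
    ∑[ b ] ⟦ g b <ᵇ suc k ⟧ + ∑[ b ] ⟦ g b ≡ᵇ suc k ⟧      ≡⟨ cong₂ _+_ (count-below k (<⇒≤ k<m)) (hits-≡1 (s≤s z≤n) k<m) ⟩
    k + 1                                                  ≡⟨ +-comm k 1 ⟩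
    suc k                                                  ∎
    where open ≡-Reasoning

  rank : ∀ a → g a ≡ suc (∑[ b ] ⟦ g b <ᵇ g a ⟧)
  rank a with g a | g-bounded a
  ... | suc k | _ , k<m = cong suc (sym (count-below k (<⇒≤ k<m)))

same-order⇒≡ : ∀ {m} {g h : Fin m → ℕ} → IsPermFn m g → IsPermFn m h →
  (∀ a b → (g b <ᵇ g a) ≡ (h b <ᵇ h a)) → ∀ a → g a ≡ h a
same-order⇒≡ {m} {g} {h} g-perm h-perm same-order a = begin
  g a                              ≡⟨ PermFn.rank g-perm a ⟩
  suc (∑[ b ] ⟦ g b <ᵇ g a ⟧)      ≡⟨ cong suc (∑-cong (allFin m) (cong ⟦_⟧ ∘ same-order a)) ⟩
  suc (∑[ b ] ⟦ h b <ᵇ h a ⟧)      ≡⟨ sym (PermFn.rank h-perm a) ⟩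
  h a                              ∎
  where open ≡-Reasoning

-- punchIn i is the increasing bijection ℕ → ℕ ∖ {i}; punchOut i is its inverse, extended by i ↦ i.
punchIn : ℕ → ℕ → ℕ
punchIn i w = if w <ᵇ i then w else suc w

punchOut : ℕ → ℕ → ℕ
punchOut i r = if i <ᵇ r then pred r else r

punchIn-< : ∀ {i w} → w < i → punchIn i w ≡ w
punchIn-< w<i rewrite <ᵇ-true w<i = refl

punchIn-≥ : ∀ {i w} → i ≤ w → punchIn i w ≡ suc w
punchIn-≥ i≤w rewrite <ᵇ-false (≤⇒≯ i≤w) = refl

punchOut-≤ : ∀ {i r} → r ≤ i → punchOut i r ≡ r
punchOut-≤ r≤i rewrite <ᵇ-false (≤⇒≯ r≤i) = refl

punchOut-> : ∀ {i r} → i < r → punchOut i r ≡ pred r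
punchOut-> i<r rewrite <ᵇ-true i<r = refl

punchIn≢ : ∀ i w → punchIn i w ≢ i
punchIn≢ i w with w <? i
... | yes w<i rewrite punchIn-< w<i = <⇒≢ w<i
... | no w≮i rewrite punchIn-≥ (≮⇒≥ w≮i) = >⇒≢ (s≤s (≮⇒≥ w≮i))

punchOut-punchIn : ∀ i w → punchOut i (punchIn i w) ≡ w
punchOut-punchIn i w with w <? i
... | yes w<i rewrite punchIn-< w<i = punchOut-≤ (<⇒≤ w<i)
... | no w≮i rewrite punchIn-≥ (≮⇒≥ w≮i) = punchOut-> (s≤s (≮⇒≥ w≮i))

punchIn-punchOut : ∀ {i r} → r ≢ i → punchIn i (punchOut i r) ≡ r
punchIn-punchOut {i} {r} r≢i with <-cmp r i
... | tri< r<i _ _ rewrite punchOut-≤ (<⇒≤ r<i) = punchIn-< r<i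
... | tri≈ _ r≡i _ = contradiction r≡i r≢i
... | tri> _ _ i<r@(s≤s i≤r′) rewrite punchOut-> i<r = punchIn-≥ i≤r′

punchIn-<ᵇ : ∀ i w q → (punchIn i w <ᵇ q) ≡ (w <ᵇ punchOut i q)
punchIn-<ᵇ i w q with w <? i | i <? q
... | yes w<i | yes i<q rewrite punchIn-< w<i | punchOut-> i<q =
  trans (<ᵇ-true (<-trans w<i i<q)) (sym (<ᵇ-true (<-≤-trans w<i (<⇒≤pred i<q))))
... | yes w<i | no i≮q rewrite punchIn-< w<i | punchOut-≤ (≮⇒≥ i≮q) = refl
... | no w≮i | yes (s≤s i≤q′) rewrite punchIn-≥ (≮⇒≥ w≮i) | punchOut-> (s≤s i≤q′) = refl
... | no w≮i | no i≮q rewrite punchIn-≥ (≮⇒≥ w≮i) | punchOut-≤ (≮⇒≥ i≮q) =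
  trans (<ᵇ-false (≤⇒≯ (≤-trans q≤w (n≤1+n w)))) (sym (<ᵇ-false (≤⇒≯ q≤w)))
  where
  q≤w = ≤-trans (≮⇒≥ i≮q) (≮⇒≥ w≮i)

punchIn-<ᵇ-punchIn : ∀ i w₁ w₂ → (punchIn i w₁ <ᵇ punchIn i w₂) ≡ (w₁ <ᵇ w₂)
punchIn-<ᵇ-punchIn i w₁ w₂ = trans (punchIn-<ᵇ i w₁ (punchIn i w₂)) (cong (w₁ <ᵇ_) (punchOut-punchIn i w₂))

≡-sym-⇔ : ∀ {a b c d : ℕ} → (a ≡ b ⇔ c ≡ d) → (b ≡ a ⇔ d ≡ c)
≡-sym-⇔ a≡b⇔c≡d = mk⇔ (sym ∘ to a≡b⇔c≡d ∘ sym) (sym ∘ from a≡b⇔c≡d ∘ sym)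

punchIn≡⇔ : ∀ {i w r} → r ≢ i → (punchIn i w ≡ r ⇔ w ≡ punchOut i r)
punchIn≡⇔ {i} {w} r≢i = mk⇔
  (λ { refl → sym (punchOut-punchIn i w) })
  (λ { refl → punchIn-punchOut r≢i })

punchIn≡⇔′ : ∀ {i w r} → w ≢ i → (punchIn i w ≡ r ⇔ w ≡ punchOut i r)
punchIn≡⇔′ {i} {w} {r} w≢i with r ≟ i
... | yes refl = mk⇔ (λ eq → contradiction eq (punchIn≢ i w)) (λ eq → contradiction (trans eq (punchOut-≤ ≤-refl)) w≢i)
... | no r≢i = punchIn≡⇔ r≢i

<ᵇ-punchIn : ∀ i w → (i <ᵇ punchIn i w) ≡ not (w <ᵇ i)
<ᵇ-punchIn i w with w <? i
... | yes w<i rewrite punchIn-< w<i | <ᵇ-true w<i = <ᵇ-false (<⇒≯ w<i)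
... | no w≮i rewrite punchIn-≥ (≮⇒≥ w≮i) | <ᵇ-false w≮i = <ᵇ-true (s≤s (≮⇒≥ w≮i))

punchOut-<-punchOut : ∀ {i p} q → p ≢ i → (p < q ⇔ punchOut i p < punchOut i q)
punchOut-<-punchOut {i} {p} q p≢i =
  <ᵇ-≡⇒⇔ (trans (cong (_<ᵇ q) (sym (punchIn-punchOut p≢i))) (punchIn-<ᵇ i (punchOut i p) q))

punchOut-bounded : ∀ {m i r} → 1 ≤ i → i ≤ suc m → 1 ≤ r → r ≤ suc m → r ≢ i → (1 ≤ punchOut i r) × (punchOut i r ≤ m)
punchOut-bounded {i = i} {r} 1≤i i≤1+m 1≤r r≤1+m r≢i with <-cmp r i
... | tri< r<i _ _ rewrite punchOut-≤ (<⇒≤ r<i) = 1≤r , ≤-pred (≤-trans r<i i≤1+m)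
... | tri≈ _ r≡i _ = contradiction r≡i r≢i
... | tri> _ _ i<r@(s≤s i≤r′) rewrite punchOut-> i<r = ≤-trans 1≤i i≤r′ , ≤-pred r≤1+m

-- punchOut i ∘ rest is a permutation of {1..m} in the same relative order as π′ = red rest, hence equal to it.
module _ {m i} {rest : Vec ℕ m} (σ-perm : IsPerm (suc m) (i ∷ rest))
         {π′ : Vec ℕ m} (π′-perm : IsPerm m π′) (rest≅π′ : OrderIso rest π′) where

  private
    rest≢i : ∀ a → lookup rest a ≢ i
    rest≢i a eq = Fin.0≢1+n (sym (proj₂ σ-perm (fsuc a) fzero eq))

    ρ : Fin m → ℕ
    ρ = punchOut i ∘ lookup rest

    punchIn-ρ : ∀ a → punchIn i (ρ a) ≡ lookup rest a
    punchIn-ρ a = punchIn-punchOut (rest≢i a)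

    ρ-perm : IsPermFn m ρ
    ρ-perm = bounded , injective
      where
      bounded : ∀ a → (1 ≤ ρ a) × (ρ a ≤ m)
      bounded a = let (1≤i , i≤1+m) = proj₁ σ-perm fzero ; (1≤r , r≤1+m) = proj₁ σ-perm (fsuc a) in
        punchOut-bounded 1≤i i≤1+m 1≤r r≤1+m (rest≢i a)
      injective : ∀ a b → ρ a ≡ ρ b → a ≡ b
      injective a b ρa≡ρb = Fin.suc-injective (proj₂ σ-perm (fsuc a) (fsuc b)
        (trans (sym (punchIn-ρ a)) (trans (cong (punchIn i) ρa≡ρb) (punchIn-ρ b))))

    ρ-order : ∀ a b → (ρ b <ᵇ ρ a) ≡ (lookup π′ b <ᵇ lookup π′ a)
    ρ-order a b = begin
      ρ b <ᵇ ρ a                              ≡⟨ sym (punchIn-<ᵇ-punchIn i (ρ b) (ρ a)) ⟩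
      punchIn i (ρ b) <ᵇ punchIn i (ρ a)      ≡⟨ cong₂ _<ᵇ_ (punchIn-ρ b) (punchIn-ρ a) ⟩
      lookup rest b <ᵇ lookup rest a          ≡⟨ <ᵇ-cong (mk⇔ (proj₁ (rest≅π′ b a)) (proj₂ (rest≅π′ b a))) ⟩
      lookup π′ b <ᵇ lookup π′ a              ∎
      where open ≡-Reasoning

  tail≡punchIn-red : ∀ a → lookup rest a ≡ punchIn i (lookup π′ a)
  tail≡punchIn-red a = trans (sym (punchIn-ρ a)) (cong (punchIn i) (same-order⇒≡ ρ-perm π′-perm ρ-order a))

isXPair : ∀ {n} → Vec ℕ n → ℕ → ℕ → Fin n → Fin n → Bool
isXPair π p q a b = (a <F b) ∧ (lookup π a ≡ᵇ p) ∧ (lookup π b <ᵇ q)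

is231 : ∀ {n} → Vec ℕ n → Fin n → Fin n → Fin n → Bool
is231 π a b c = (a <F b) ∧ (b <F c) ∧ (lookup π c <ᵇ lookup π a) ∧ (lookup π a <ᵇ lookup π b)

xexp-∑ : ∀ {n} (π : Vec ℕ n) p q → xexp π p q ≡ ∑[ a ] ∑[ b ] ⟦ isXPair π p q a b ⟧
xexp-∑ {n} π p q = trans (∑-countL _ (pairs n)) (∑-cartesianProduct (allFin n) (allFin n) _)

N231-∑ : ∀ {n} (π : Vec ℕ n) → N231 π ≡ ∑[ a ] ∑[ b ] ∑[ c ] ⟦ is231 π a b c ⟧
N231-∑ {n} π = trans (∑-countL _ (triples n)) (trans (∑-cartesianProduct (allFin n) (pairs n) _)
  (∑-cong (allFin n) (λ a → ∑-cartesianProduct (allFin n) (allFin n) _)))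

N231-order-invariant : ∀ {n} {σ τ : Vec ℕ n} → (∀ a b → (lookup σ a <ᵇ lookup σ b) ≡ (lookup τ a <ᵇ lookup τ b)) →
  N231 σ ≡ N231 τ
N231-order-invariant {n} {σ} {τ} same-order = begin
  N231 σ                                  ≡⟨ N231-∑ σ ⟩
  ∑[ a ] ∑[ b ] ∑[ c ] ⟦ is231 σ a b c ⟧   ≡⟨ ∑-cong (allFin n) (λ a → ∑-cong (allFin n) (λ b → ∑-cong (allFin n) (λ c →
                                               cong ⟦_⟧ (cong₂ (λ u v → (a <F b) ∧ (b <F c) ∧ u ∧ v) (same-order c a) (same-order a b))))) ⟩
  ∑[ a ] ∑[ b ] ∑[ c ] ⟦ is231 τ a b c ⟧   ≡⟨ sym (N231-∑ τ) ⟩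
  N231 τ                                  ∎
  where open ≡-Reasoning

xexp-punchIn : ∀ {n i p} {σ τ : Vec ℕ n} → p ≢ i → (∀ a → lookup σ a ≡ punchIn i (lookup τ a)) →
  ∀ q → xexp σ p q ≡ xexp τ (punchOut i p) (punchOut i q)
xexp-punchIn {n} {i} {p} {σ} {τ} p≢i σ≡punchInτ q = begin
  xexp σ p q
    ≡⟨ xexp-∑ σ p q ⟩
  ∑[ a ] ∑[ b ] ⟦ isXPair σ p q a b ⟧
    ≡⟨ ∑-cong (allFin n) (λ a → ∑-cong (allFin n) (λ b → cong ⟦_⟧ (same-pair a b))) ⟩
  ∑[ a ] ∑[ b ] ⟦ isXPair τ (punchOut i p) (punchOut i q) a b ⟧
    ≡⟨ sym (xexp-∑ τ (punchOut i p) (punchOut i q)) ⟩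
  xexp τ (punchOut i p) (punchOut i q)
    ∎
  where
  open ≡-Reasoning
  same-pair : ∀ a b → isXPair σ p q a b ≡ isXPair τ (punchOut i p) (punchOut i q) a b
  same-pair a b rewrite σ≡punchInτ a | σ≡punchInτ b =
    cong₂ (λ u v → (a <F b) ∧ u ∧ v) (≡ᵇ-cong (punchIn≡⇔ p≢i)) (punchIn-<ᵇ i _ q)

module _ {m} (i : ℕ) (rest : Vec ℕ m) where

  private
    σ = i ∷ rest

  xexp-∷ : ∀ p q → xexp (i ∷ rest) p q ≡ ∑[ b ] ⟦ (i ≡ᵇ p) ∧ (lookup rest b <ᵇ q) ⟧ + xexp rest p q
  xexp-∷ p q = begin
    xexp σ p q
      ≡⟨ xexp-∑ σ p q ⟩
    ∑[ a ] ∑[ b ] ⟦ isXPair σ p q a b ⟧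
      ≡⟨ ∑ᶠ-suc (λ a → ∑[ b ] ⟦ isXPair σ p q a b ⟧) ⟩
    ∑[ b ] ⟦ isXPair σ p q fzero b ⟧ + ∑[ a ] ∑[ b ] ⟦ isXPair σ p q (fsuc a) b ⟧
      ≡⟨ cong₂ _+_ (∑ᶠ-suc (λ b → ⟦ isXPair σ p q fzero b ⟧))
                   (∑-cong (allFin m) (λ a → ∑ᶠ-suc (λ b → ⟦ isXPair σ p q (fsuc a) b ⟧))) ⟩
    ∑[ b ] ⟦ (i ≡ᵇ p) ∧ (lookup rest b <ᵇ q) ⟧ + ∑[ a ] ∑[ b ] ⟦ isXPair rest p q a b ⟧
      ≡⟨ cong (∑[ b ] ⟦ (i ≡ᵇ p) ∧ (lookup rest b <ᵇ q) ⟧ +_) (sym (xexp-∑ rest p q)) ⟩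
    ∑[ b ] ⟦ (i ≡ᵇ p) ∧ (lookup rest b <ᵇ q) ⟧ + xexp rest p q
      ∎
    where open ≡-Reasoning

  N231-∷ : N231 (i ∷ rest) ≡ ∑[ b ] ∑[ c ] ⟦ (b <F c) ∧ (lookup rest c <ᵇ i) ∧ (i <ᵇ lookup rest b) ⟧ + N231 rest
  N231-∷ = trans (N231-∑ σ) (trans (∑ᶠ-suc (λ a → ∑[ b ] ∑[ c ] ⟦ is231 σ a b c ⟧)) (cong₂ _+_ first-row later-rows))
    where
    first-row : ∑[ b ] ∑[ c ] ⟦ is231 σ fzero b c ⟧ ≡ ∑[ b ] ∑[ c ] ⟦ (b <F c) ∧ (lookup rest c <ᵇ i) ∧ (i <ᵇ lookup rest b) ⟧
    first-row = trans (∑ᶠ-suc (λ b → ∑[ c ] ⟦ is231 σ fzero b c ⟧))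
      (cong₂ _+_ (∑-0 (allFin (suc m)) λ _ → refl) (∑-cong (allFin m) (λ b → ∑ᶠ-suc (λ c → ⟦ is231 σ fzero (fsuc b) c ⟧))))
    later-row : ∀ a → ∑[ b ] ∑[ c ] ⟦ is231 σ (fsuc a) b c ⟧ ≡ ∑[ b ] ∑[ c ] ⟦ is231 rest a b c ⟧
    later-row a = trans (∑ᶠ-suc (λ b → ∑[ c ] ⟦ is231 σ (fsuc a) b c ⟧)) (cong₂ _+_ (∑-0 (allFin (suc m)) λ _ → refl)
      (∑-cong (allFin m) (λ b → trans (∑ᶠ-suc (λ c → ⟦ is231 σ (fsuc a) (fsuc b) c ⟧))
        (cong (λ k → ⟦ k ⟧ + ∑[ c ] ⟦ is231 rest a b c ⟧) (∧-zeroʳ (a <F b))))))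
    later-rows : ∑[ a ] ∑[ b ] ∑[ c ] ⟦ is231 σ (fsuc a) b c ⟧ ≡ N231 rest
    later-rows = trans (∑-cong (allFin m) later-row) (sym (N231-∑ rest))

∑△ : ℕ → (ℕ → ℕ → ℕ) → ℕ
∑△ n f = ∑ (range1 n) (λ b → ∑ (range1 b) (f b))

∑△-*-zeroʳ : ∀ n (e : ℕ → ℕ → ℕ) → ∑△ n (λ b c → e b c * 0) ≡ 0
∑△-*-zeroʳ n e = ∑-0 (range1 n) λ b → ∑-0 (range1 b) λ c → *-zeroʳ (e b c)

∑△-cong : ∀ n {f g : ℕ → ℕ → ℕ} → (∀ {b c} → 1 ≤ c → c ≤ b → f b c ≡ g b c) → ∑△ n f ≡ ∑△ n g
∑△-cong n f≗g = ∑-cong (range1 n) λ b → ∑-cong-∈ (range1 b) λ c∈ → let (1≤c , c≤b) = ∈-range1⁻ c∈ in f≗g 1≤c c≤b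

∑-weight : ∀ {m} (π : Vec ℕ m) (f : Var → ℕ) → ∑ (weight π) f ≡ N231 π * f t + ∑△ m (λ b c → xexp π b c * f (x b c))
∑-weight {m} π f = begin
  ∑ (weight π) f
    ≡⟨ ∑-++ (replicate (N231 π) t) _ f ⟩
  ∑ (replicate (N231 π) t) f + ∑ (concatMap row (range1 m)) f
    ≡⟨ cong₂ _+_ (∑-replicate (N231 π) t f) (trans (∑-concatMap (range1 m) row f) (∑-cong (range1 m) λ b →
         trans (∑-concatMap (range1 b) (λ c → replicate (xexp π b c) (x b c)) f)
               (∑-cong (range1 b) λ c → ∑-replicate (xexp π b c) (x b c) f))) ⟩
  N231 π * f t + ∑△ m (λ b c → xexp π b c * f (x b c))
    ∎
  where
  open ≡-Reasoning
  row : ℕ → List Var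
  row b = concatMap (λ c → replicate (xexp π b c) (x b c)) (range1 b)

∑-prefix : ∀ i (f : Var → ℕ) → ∑ (prefix i) f ≡ ∑ (range1 i) (λ j → (j ∸ 1) * f (x i j))
∑-prefix i f = trans (∑-concatMap (range1 i) _ f) (∑-cong (range1 i) λ j → ∑-replicate (j ∸ 1) (x i j) f)

Triangle : ℕ → ℕ → ℕ → Set
Triangle n p q = (1 ≤ q) × (q ≤ p) × (p ≤ n)

triangle? : ∀ n p q → Dec (Triangle n p q)
triangle? n p q = (1 ≤? q) ×-dec (q ≤? p) ×-dec (p ≤? n)

module _ (n : ℕ) (e : ℕ → ℕ → ℕ) where

  ∑△-δ-in : ∀ {p q} → Triangle n p q → ∑△ n (λ b c → e b c * δ (x p q) (x b c)) ≡ e p q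
  ∑△-δ-in {p} {q} (1≤q , q≤p , p≤n) = begin
    ∑△ n (λ b c → e b c * δ (x p q) (x b c))       ≡⟨ ∑-range1-single n _ (≤-trans 1≤q q≤p) p≤n off-row ⟩
    ∑ (range1 p) (λ c → e p c * δ (x p q) (x p c)) ≡⟨ ∑-range1-single p _ 1≤q q≤p off-column ⟩
    e p q * δ (x p q) (x p q)                      ≡⟨ cong (e p q *_) (δ-refl (x p q)) ⟩
    e p q * 1                                      ≡⟨ *-identityʳ (e p q) ⟩
    e p q                                          ∎
    where
    open ≡-Reasoning
    off-row : ∀ b → b ≢ p → ∑ (range1 b) (λ c → e b c * δ (x p q) (x b c)) ≡ 0
    off-row b b≢p = ∑-0 (range1 b) λ c → trans (cong (e b c *_) (δ-x-≢ˡ {p} {q} {b} {c} (b≢p ∘ sym))) (*-zeroʳ (e b c))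
    off-column : ∀ c → c ≢ q → e p c * δ (x p q) (x p c) ≡ 0
    off-column c c≢q = trans (cong (e p c *_) (δ-x-≢ʳ {p} {q} {p} {c} (c≢q ∘ sym))) (*-zeroʳ (e p c))

  ∑△-δ-out : ∀ {p q} → ¬ Triangle n p q → ∑△ n (λ b c → e b c * δ (x p q) (x b c)) ≡ 0
  ∑△-δ-out {p} {q} ∉△ = ∑-range1-0 n _ λ b _ b≤n → ∑-range1-0 b _ λ c 1≤c c≤b →
    trans (cong (e b c *_) (δ-≢ {x p q} {x b c} λ { refl → ∉△ (1≤c , c≤b , b≤n) })) (*-zeroʳ (e b c))

∑△-δ-cong : ∀ {n n′ e e′ p q p′ q′} → (Triangle n p q ⇔ Triangle n′ p′ q′) → (Triangle n p q → e p q ≡ e′ p′ q′) →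
  ∑△ n (λ b c → e b c * δ (x p q) (x b c)) ≡ ∑△ n′ (λ b c → e′ b c * δ (x p′ q′) (x b c))
∑△-δ-cong {n} {n′} {e} {e′} {p} {q} △⇔△′ e≡e′ with triangle? n p q
... | yes ∈△ = trans (∑△-δ-in n e ∈△) (trans (e≡e′ ∈△) (sym (∑△-δ-in n′ e′ (to △⇔△′ ∈△))))
... | no ∉△ = trans (∑△-δ-out n e ∉△) (sym (∑△-δ-out n′ e′ (∉△ ∘ from △⇔△′)))

triangle-punchOut : ∀ {m i p q} → 1 ≤ i → i ≤ suc m → p ≢ i → Triangle (suc m) p q ⇔ Triangle m (punchOut i p) (punchOut i q)
triangle-punchOut {m} {i} {p} {q} 1≤i i≤1+m p≢i = mk⇔
  (λ (1≤q , q≤p , p≤1+m) → to 1≤⇔ 1≤q , to ≤⇔ q≤p , ≤-pred (to ≤1+m⇔ (s≤s p≤1+m)))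
  (λ (1≤Q , Q≤P , P≤m) → from 1≤⇔ 1≤Q , from ≤⇔ Q≤P , ≤-pred (from ≤1+m⇔ (s≤s P≤m)))
  where
  1≤⇔ : 1 ≤ q ⇔ 1 ≤ punchOut i q
  1≤⇔ = <ᵇ-≡⇒⇔ (trans (cong (_<ᵇ q) (sym (punchIn-< 1≤i))) (punchIn-<ᵇ i 0 q))
  ≤⇔ : q ≤ p ⇔ punchOut i q ≤ punchOut i p
  ≤⇔ = mk⇔ (λ q≤p → ≮⇒≥ (≤⇒≯ q≤p ∘ from (punchOut-<-punchOut q p≢i)))
           (λ Q≤P → ≮⇒≥ (≤⇒≯ Q≤P ∘ to (punchOut-<-punchOut q p≢i)))
  ≤1+m⇔ : p < suc (suc m) ⇔ punchOut i p < suc m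
  ≤1+m⇔ = subst (λ r → p < suc (suc m) ⇔ punchOut i p < r) (punchOut-> (s≤s i≤1+m)) (punchOut-<-punchOut (suc (suc m)) p≢i)

substA-off : ∀ {i b c} → c ≢ i → c ≤ b → substA i (x b c) ≡ x (punchIn i b) (punchIn i c) ∷ []
substA-off {i} {b} {c} c≢i c≤b with b <? i
... | yes b<i rewrite <ᵇ-true b<i | <ᵇ-true (≤-<-trans c≤b b<i) = refl
... | no b≮i with <-cmp c i
...   | tri< c<i _ _ rewrite <ᵇ-false b≮i | <ᵇ-true c<i = refl
...   | tri≈ _ c≡i _ = contradiction c≡i c≢i
...   | tri> _ _ i<c rewrite <ᵇ-false b≮i | <ᵇ-false (<⇒≯ i<c) | <ᵇ-true i<c = refl

substA-on : ∀ {i b} → i ≤ b → substA i (x b i) ≡ t ∷ x (suc b) i ∷ x (suc b) (suc i) ∷ []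
substA-on {i} i≤b rewrite <ᵇ-false (≤⇒≯ i≤b) | <ᵇ-false (n≮n i) = refl

mult-t-substA : ∀ {i b c} → c ≤ b → mult t (substA i (x b c)) ≡ ⟦ c ≡ᵇ i ⟧
mult-t-substA {i} {b} {c} c≤b with c ≟ i
... | yes refl rewrite substA-on c≤b | ≡ᵇ-refl c = refl
... | no c≢i rewrite substA-off c≢i c≤b | ≡ᵇ-false c≢i = refl

mult-x-substA-on : ∀ {i q b c} → c ≤ b → mult (x i q) (substA i (x b c)) ≡ 0
mult-x-substA-on {i} {q} {b} {c} c≤b with c ≟ i
... | yes refl rewrite substA-on c≤b
  | δ-x-≢ˡ {c} {q} {suc b} {c} (<⇒≢ (s≤s c≤b)) | δ-x-≢ˡ {c} {q} {suc b} {suc c} (<⇒≢ (s≤s c≤b)) = refl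
... | no c≢i rewrite substA-off c≢i c≤b | δ-x-≢ˡ {i} {q} {punchIn i b} {punchIn i c} (punchIn≢ i b ∘ sym) = refl

mult-x-substA-off : ∀ {i p q b c} → p ≢ i → c ≤ b →
  mult (x p q) (substA i (x b c)) ≡ δ (x (punchOut i p) (punchOut i q)) (x b c)
mult-x-substA-off {i} {p} {q} {b} {c} p≢i c≤b with c ≟ i
... | no c≢i rewrite substA-off c≢i c≤b =
  trans (+-identityʳ _) (δ-x-cong (≡-sym-⇔ (punchIn≡⇔ p≢i)) (≡-sym-⇔ (punchIn≡⇔′ c≢i)))
... | yes refl rewrite substA-on c≤b = on-column
  where
  -- punchOut c merges the columns c and c + 1, the two x-factors of A(x_{b,c}).
  row⇔ : p ≡ suc b ⇔ punchOut c p ≡ b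
  row⇔ = subst (λ r → p ≡ r ⇔ punchOut c p ≡ b) (punchIn-≥ c≤b) (≡-sym-⇔ (punchIn≡⇔ p≢i))
  on-column : δ (x p q) (x (suc b) c) + (δ (x p q) (x (suc b) (suc c)) + 0) ≡ δ (x (punchOut c p) (punchOut c q)) (x b c)
  on-column with <-cmp q c
  ... | tri< q<c _ _ rewrite δ-x-≢ʳ {p} {q} {suc b} {c} (<⇒≢ q<c) | δ-x-≢ʳ {p} {q} {suc b} {suc c} (<⇒≢ (m<n⇒m<1+n q<c))
        | punchOut-≤ (<⇒≤ q<c) = sym (δ-x-≢ʳ {punchOut c p} {q} {b} {c} (<⇒≢ q<c))
  ... | tri≈ _ refl _ rewrite δ-x-≢ʳ {p} {q} {suc b} {suc q} (<⇒≢ (n<1+n q)) | punchOut-≤ (≤-refl {q}) =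
        trans (+-identityʳ _) (δ-x-cong row⇔ (mk⇔ id id))
  ... | tri> _ _ c<q@(s≤s _) rewrite δ-x-≢ʳ {p} {q} {suc b} {c} (>⇒≢ c<q) | punchOut-> c<q =
        trans (+-identityʳ _) (δ-x-cong row⇔ (mk⇔ (cong pred) (cong suc)))

∑△-column : ∀ {i} n (e : ℕ → ℕ → ℕ) → 1 ≤ i →
  ∑△ n (λ b c → e b c * ⟦ c ≡ᵇ i ⟧) ≡ ∑ (range1 n) (λ b → if b <ᵇ i then 0 else e b i)
∑△-column {i} n e 1≤i = ∑-cong (range1 n) row
  where
  row : ∀ b → ∑ (range1 b) (λ c → e b c * ⟦ c ≡ᵇ i ⟧) ≡ (if b <ᵇ i then 0 else e b i)
  row b with b <? i
  ... | yes b<i rewrite <ᵇ-true b<i = ∑-range1-0 b _ λ c _ c≤b →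
          trans (cong (λ k → e b c * ⟦ k ⟧) (≡ᵇ-false (<⇒≢ (≤-<-trans c≤b b<i)))) (*-zeroʳ (e b c))
  ... | no b≮i rewrite <ᵇ-false b≮i = begin
    ∑ (range1 b) (λ c → e b c * ⟦ c ≡ᵇ i ⟧)  ≡⟨ ∑-range1-single b _ 1≤i (≮⇒≥ b≮i) (λ c c≢i →
                                                  trans (cong (λ k → e b c * ⟦ k ⟧) (≡ᵇ-false c≢i)) (*-zeroʳ (e b c))) ⟩
    e b i * ⟦ i ≡ᵇ i ⟧                       ≡⟨ cong (λ k → e b i * ⟦ k ⟧) (≡ᵇ-refl i) ⟩
    e b i * 1                                ≡⟨ *-identityʳ (e b i) ⟩
    e b i                                    ∎
    where open ≡-Reasoning

module Reduction {m i : ℕ} (rest π′ : Vec ℕ m) (1≤i : 1 ≤ i) (i≤1+m : i ≤ suc m) (π′-perm : IsPerm m π′)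
                 (rest≡punchInπ′ : ∀ a → lookup rest a ≡ punchIn i (lookup π′ a)) where

  private
    σ = i ∷ rest

    rest-<ᵇ-i : ∀ a → (lookup rest a <ᵇ i) ≡ (lookup π′ a <ᵇ i)
    rest-<ᵇ-i a = trans (cong (_<ᵇ i) (rest≡punchInπ′ a))
      (trans (punchIn-<ᵇ i _ i) (cong (lookup π′ a <ᵇ_) (punchOut-≤ {i} {i} ≤-refl)))

    rest≢i : ∀ a → lookup rest a ≢ i
    rest≢i a = punchIn≢ i (lookup π′ a) ∘ trans (sym (rest≡punchInπ′ a))

    i-<ᵇ-rest : ∀ a → (i <ᵇ lookup rest a) ≡ not (lookup π′ a <ᵇ i)
    i-<ᵇ-rest a = trans (cong (i <ᵇ_) (rest≡punchInπ′ a)) (<ᵇ-punchIn i _)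

  xexp-∷-off : ∀ {p} q → p ≢ i → xexp σ p q ≡ xexp π′ (punchOut i p) (punchOut i q)
  xexp-∷-off {p} q p≢i = trans (xexp-∷ i rest p q)
    (trans (cong (_+ xexp rest p q) first-row) (xexp-punchIn {σ = rest} {τ = π′} p≢i rest≡punchInπ′ q))
    where
    first-row : ∑[ b ] ⟦ (i ≡ᵇ p) ∧ (lookup rest b <ᵇ q) ⟧ ≡ 0
    first-row = ∑-0 (allFin m) λ b → cong (λ k → ⟦ k ∧ (lookup rest b <ᵇ q) ⟧) (≡ᵇ-false (p≢i ∘ sym))

  xexp-∷-on : ∀ {q} → 1 ≤ q → q ≤ i → xexp σ i q ≡ q ∸ 1
  xexp-∷-on {suc k} _ q≤i = trans (xexp-∷ i rest i (suc k)) (trans (cong₂ _+_ first-row later-rows) (+-identityʳ k))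
    where
    first-row : ∑[ b ] ⟦ (i ≡ᵇ i) ∧ (lookup rest b <ᵇ suc k) ⟧ ≡ k
    first-row = trans (∑-cong (allFin m) λ b → cong ⟦_⟧ (trans (cong (_∧ (lookup rest b <ᵇ suc k)) (≡ᵇ-refl i))
                  (trans (cong (_<ᵇ suc k) (rest≡punchInπ′ b)) (trans (punchIn-<ᵇ i _ (suc k)) (cong (lookup π′ b <ᵇ_) (punchOut-≤ q≤i))))))
                (PermFn.count-below π′-perm k (≤-pred (≤-trans q≤i i≤1+m)))
    later-rows : xexp rest i (suc k) ≡ 0
    later-rows = trans (xexp-∑ rest i (suc k)) (∑-0 (allFin m) λ a → ∑-0 (allFin m) λ b →
      cong ⟦_⟧ (trans (cong (λ u → (a <F b) ∧ u ∧ (lookup rest b <ᵇ suc k)) (≡ᵇ-false (rest≢i a))) (∧-zeroʳ (a <F b))))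

  new-231s : ∑[ b ] ∑[ c ] ⟦ (b <F c) ∧ (lookup rest c <ᵇ i) ∧ (i <ᵇ lookup rest b) ⟧
           ≡ ∑ (range1 m) (λ r → if r <ᵇ i then 0 else xexp π′ r i)
  new-231s = sym (begin
    ∑ (range1 m) (λ r → if r <ᵇ i then 0 else xexp π′ r i)
      ≡⟨ ∑-cong (range1 m) (λ r → trans (cong (λ k → if r <ᵇ i then 0 else k) (xexp-∑ π′ r i))
           (trans (∑-if (r <ᵇ i) (allFin m) _) (∑-cong (allFin m) λ a → ∑-if (r <ᵇ i) (allFin m) _))) ⟩
    ∑ (range1 m) (λ r → ∑[ b ] ∑[ c ] (if r <ᵇ i then 0 else ⟦ isXPair π′ r i b c ⟧))
      ≡⟨ trans (∑-swap (range1 m) (allFin m) _) (∑-cong (allFin m) λ b → ∑-swap (range1 m) (allFin m) _) ⟩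
    ∑[ b ] ∑[ c ] ∑ (range1 m) (λ r → if r <ᵇ i then 0 else ⟦ isXPair π′ r i b c ⟧)
      ≡⟨ ∑-cong (allFin m) (λ b → ∑-cong (allFin m) λ c → only-r≡π′b b c) ⟩
    ∑[ b ] ∑[ c ] (if lookup π′ b <ᵇ i then 0 else ⟦ (b <F c) ∧ (lookup π′ c <ᵇ i) ⟧)
      ≡⟨ ∑-cong (allFin m) (λ b → ∑-cong (allFin m) λ c → sym (trans
           (cong₂ (λ u v → ⟦ (b <F c) ∧ u ∧ v ⟧) (rest-<ᵇ-i c) (i-<ᵇ-rest b)) (⟦∧∧not⟧ (b <F c) _ _))) ⟩
    ∑[ b ] ∑[ c ] ⟦ (b <F c) ∧ (lookup rest c <ᵇ i) ∧ (i <ᵇ lookup rest b) ⟧ ∎)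
    where
    open ≡-Reasoning
    only-r≡π′b : ∀ b c → ∑ (range1 m) (λ r → if r <ᵇ i then 0 else ⟦ isXPair π′ r i b c ⟧)
                       ≡ (if lookup π′ b <ᵇ i then 0 else ⟦ (b <F c) ∧ (lookup π′ c <ᵇ i) ⟧)
    only-r≡π′b b c = let (1≤π′b , π′b≤m) = proj₁ π′-perm b in
      trans (∑-range1-single m _ 1≤π′b π′b≤m off)
            (cong (λ k → if lookup π′ b <ᵇ i then 0 else ⟦ (b <F c) ∧ k ∧ (lookup π′ c <ᵇ i) ⟧) (≡ᵇ-refl (lookup π′ b)))
      where
      off : ∀ r → r ≢ lookup π′ b → (if r <ᵇ i then 0 else ⟦ isXPair π′ r i b c ⟧) ≡ 0
      off r r≢π′b with r <ᵇ i
      ... | true = refl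
      ... | false = trans (cong (λ k → ⟦ (b <F c) ∧ k ∧ (lookup π′ c <ᵇ i) ⟧) (≡ᵇ-false (r≢π′b ∘ sym)))
                          (cong ⟦_⟧ (∧-zeroʳ (b <F c)))

  N231-∷-red : N231 σ ≡ ∑ (range1 m) (λ r → if r <ᵇ i then 0 else xexp π′ r i) + N231 π′
  N231-∷-red = trans (N231-∷ i rest) (cong₂ _+_ new-231s (N231-order-invariant {σ = rest} {τ = π′} same-order))
    where
    same-order : ∀ a b → (lookup rest a <ᵇ lookup rest b) ≡ (lookup π′ a <ᵇ lookup π′ b)
    same-order a b = trans (cong₂ _<ᵇ_ (rest≡punchInπ′ a) (rest≡punchInπ′ b)) (punchIn-<ᵇ-punchIn i _ _)

  private
    mult-rhs : ∀ v → mult v (prefix i ++ applyA i (weight π′)) ≡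
      ∑ (range1 i) (λ j → (j ∸ 1) * δ v (x i j)) + (N231 π′ * mult v (substA i t) + ∑△ m (λ b c → xexp π′ b c * mult v (substA i (x b c))))
    mult-rhs v = trans (mult-++ v (prefix i) _)
      (cong₂ _+_ (∑-prefix i (δ v)) (trans (∑-concatMap (weight π′) (substA i) (δ v)) (∑-weight π′ _)))

  mult-t : mult t (weight σ) ≡ mult t (prefix i ++ applyA i (weight π′))
  mult-t = begin
    mult t (weight σ)                                     ≡⟨ ∑-weight σ (δ t) ⟩
    N231 σ * 1 + ∑△ (suc m) (λ b c → xexp σ b c * 0)     ≡⟨ cong₂ _+_ (*-identityʳ (N231 σ)) (∑△-*-zeroʳ (suc m) (xexp σ)) ⟩
    N231 σ + 0                                            ≡⟨ +-identityʳ (N231 σ) ⟩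
    N231 σ                                                ≡⟨ N231-∷-red ⟩
    new + N231 π′                                         ≡⟨ +-comm new (N231 π′) ⟩
    N231 π′ + new                                         ≡⟨ cong₂ _+_ (sym (*-identityʳ (N231 π′))) (sym substituted≡new) ⟩
    N231 π′ * 1 + substituted                             ≡⟨ cong (_+ (N231 π′ * 1 + substituted)) (sym prefix-free-of-t) ⟩
    prefix-part + (N231 π′ * 1 + substituted)             ≡⟨ sym (mult-rhs t) ⟩
    mult t (prefix i ++ applyA i (weight π′))             ∎
    where
    open ≡-Reasoning
    new = ∑ (range1 m) (λ r → if r <ᵇ i then 0 else xexp π′ r i)
    substituted = ∑△ m (λ b c → xexp π′ b c * mult t (substA i (x b c)))
    prefix-part = ∑ (range1 i) (λ j → (j ∸ 1) * δ t (x i j))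
    prefix-free-of-t : prefix-part ≡ 0
    prefix-free-of-t = ∑-0 (range1 i) λ j → *-zeroʳ (j ∸ 1)
    substituted≡new : substituted ≡ new
    substituted≡new = trans (∑△-cong m λ {b} {c} _ c≤b → cong (xexp π′ b c *_) (mult-t-substA c≤b)) (∑△-column m (xexp π′) 1≤i)

  mult-x-off : ∀ {p} q → p ≢ i → mult (x p q) (weight σ) ≡ mult (x p q) (prefix i ++ applyA i (weight π′))
  mult-x-off {p} q p≢i = begin
    mult (x p q) (weight σ)                                              ≡⟨ ∑-weight σ (δ (x p q)) ⟩
    N231 σ * 0 + ∑△ (suc m) (λ b c → xexp σ b c * δ (x p q) (x b c))
      ≡⟨ cong₂ _+_ (*-zeroʳ (N231 σ))
                   (∑△-δ-cong {e = xexp σ} {e′ = xexp π′} (triangle-punchOut 1≤i i≤1+m p≢i) (λ _ → xexp-∷-off q p≢i)) ⟩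
    0 + ∑△ m (λ b c → xexp π′ b c * δ (x (punchOut i p) (punchOut i q)) (x b c))
      ≡⟨ cong₂ _+_ (sym prefix-free-of-x) (cong₂ _+_ (sym (*-zeroʳ (N231 π′)))
           (∑△-cong m λ {b} {c} _ c≤b → cong (xexp π′ b c *_) (sym (mult-x-substA-off p≢i c≤b)))) ⟩
    ∑ (range1 i) (λ j → (j ∸ 1) * δ (x p q) (x i j)) + (N231 π′ * 0 + ∑△ m (λ b c → xexp π′ b c * mult (x p q) (substA i (x b c))))
      ≡⟨ sym (mult-rhs (x p q)) ⟩
    mult (x p q) (prefix i ++ applyA i (weight π′))                      ∎
    where
    open ≡-Reasoning
    prefix-free-of-x : ∑ (range1 i) (λ j → (j ∸ 1) * δ (x p q) (x i j)) ≡ 0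
    prefix-free-of-x = ∑-0 (range1 i) λ j → trans (cong ((j ∸ 1) *_) (δ-x-≢ˡ {p} {q} {i} {j} p≢i)) (*-zeroʳ (j ∸ 1))

  mult-x-on : ∀ q → mult (x i q) (weight σ) ≡ mult (x i q) (prefix i ++ applyA i (weight π′))
  mult-x-on q = begin
    mult (x i q) (weight σ)            ≡⟨ ∑-weight σ (δ (x i q)) ⟩
    N231 σ * 0 + row-i-of-σ            ≡⟨ cong (_+ row-i-of-σ) (*-zeroʳ (N231 σ)) ⟩
    row-i-of-σ                         ≡⟨ row-i ⟩
    row-i-of-prefix                    ≡⟨ sym (+-identityʳ row-i-of-prefix) ⟩
    row-i-of-prefix + 0                ≡⟨ cong (row-i-of-prefix +_) (sym substituted-free-of-row-i) ⟩
    row-i-of-prefix + (N231 π′ * 0 + ∑△ m (λ b c → xexp π′ b c * mult (x i q) (substA i (x b c))))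
                                       ≡⟨ sym (mult-rhs (x i q)) ⟩
    mult (x i q) (prefix i ++ applyA i (weight π′)) ∎
    where
    open ≡-Reasoning
    row-i-of-σ = ∑△ (suc m) (λ b c → xexp σ b c * δ (x i q) (x b c))
    row-i-of-prefix = ∑ (range1 i) (λ j → (j ∸ 1) * δ (x i q) (x i j))
    row-i : row-i-of-σ ≡ row-i-of-prefix
    row-i with triangle? (suc m) i q
    ... | yes ∈△@(1≤q , q≤i , _) = begin
      ∑△ (suc m) (λ b c → xexp σ b c * δ (x i q) (x b c))   ≡⟨ ∑△-δ-in (suc m) (xexp σ) ∈△ ⟩
      xexp σ i q                                             ≡⟨ xexp-∷-on 1≤q q≤i ⟩
      q ∸ 1                                                  ≡⟨ sym (*-identityʳ (q ∸ 1)) ⟩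
      (q ∸ 1) * 1                                            ≡⟨ cong ((q ∸ 1) *_) (sym (δ-refl (x i q))) ⟩
      (q ∸ 1) * δ (x i q) (x i q)                            ≡⟨ sym (∑-range1-single i _ 1≤q q≤i λ j j≢q →
                                                                  trans (cong ((j ∸ 1) *_) (δ-x-≢ʳ {i} {q} {i} {j} (j≢q ∘ sym))) (*-zeroʳ (j ∸ 1))) ⟩
      ∑ (range1 i) (λ j → (j ∸ 1) * δ (x i q) (x i j))       ∎
    ... | no ∉△ = trans (∑△-δ-out (suc m) (xexp σ) ∉△) (sym (∑-range1-0 i _ λ j 1≤j j≤i →
      trans (cong ((j ∸ 1) *_) (δ-x-≢ʳ {i} {q} {i} {j} λ { refl → ∉△ (1≤j , j≤i , i≤1+m) })) (*-zeroʳ (j ∸ 1))))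
    substituted-free-of-row-i : N231 π′ * 0 + ∑△ m (λ b c → xexp π′ b c * mult (x i q) (substA i (x b c))) ≡ 0
    substituted-free-of-row-i = cong₂ _+_ (*-zeroʳ (N231 π′))
      (trans (∑△-cong m λ {b} {c} _ c≤b → cong (xexp π′ b c *_) (mult-x-substA-on {i} {q} c≤b)) (∑△-*-zeroʳ m (xexp π′)))

  mult-weight-∷ : ∀ v → mult v (weight σ) ≡ mult v (prefix i ++ applyA i (weight π′))
  mult-weight-∷ t = mult-t
  mult-weight-∷ (x p q) with p ≟ i
  ... | yes refl = mult-x-on q
  ... | no p≢i = mult-x-off q p≢i

mainTheorem5 : (m : ℕ) (i : ℕ) (rest : Vec ℕ m) → IsPerm (suc m) (i ∷ rest) →
    (π' : Vec ℕ m) → IsPerm m π' → OrderIso rest π' →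
    weight (i ∷ rest) ↭ prefix i ++ applyA i (weight π')
mainTheorem5 m i rest σ-perm π′ π′-perm rest≅π′ = mult-≡⇒↭ (weight (i ∷ rest)) (prefix i ++ applyA i (weight π′))
  (Reduction.mult-weight-∷ rest π′ 1≤i i≤1+m π′-perm (tail≡punchIn-red σ-perm {π′ = π′} π′-perm rest≅π′))
  where
  1≤i = proj₁ (proj₁ σ-perm fzero)
  i≤1+m = proj₂ (proj₁ σ-perm fzero)
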